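{- Let $G$ be a connected graph containing no $5$-hole and no $7$-hole, and let $H$ be an induced subgraph of $G$ that contains a shortest odd hole of $G$. (1) If $G$ is non-shallow, then so is $H$. (2) If $G$ is non-deep, then so is $H$.
   Context: A hole is an induced cycle with at least four edges; a $k$-hole has $k$ edges; odd if $k$ odd; a shortest odd hole of a graph is an odd hole of minimum length in that graph. $\|P\|$ is the number of edges of $P$. For a graph $F$ and $S\subseteq V(F)$: $F[S]$ is the induced subgraph, $N_F[S]$ is $S$ plus all vertices of $F$ adjacent to $S$, $F-S=F[V(F)\setminus S]$. Shallow (for a graph $F$): for a hole $C$ of $F$, $D\subseteq V(F)$ with $|D|\le5$ is a spade for $C$ in $F$ if (1) $C[D]$ is a $uv$-path, (2) $F[D]$ contains an induced $uv$-path of length $\|C[D]\|\pm1$, (3) with $B=N_F[D\setminus\{u,v\}]\setminus\{u,v\}$, $C-B$ is a shortest $uv$-path of $F-B$. A shallow hole of $F$ is a shortest odd hole of $F$ for which a spade exists in $F$; $F$ is shallow if it has a shallow hole, non-shallow otherwise. Deep (for a graph $F$): a triple $T=(T_1,T_2,T_3)$, $T_i$ an $ab_i$-path of $F$ with common end $a$, $\|T_1\|<\|T_2\|\le\|T_3\|$, satisfies Conditions Z in $F$ if (Z1) $\{b_1,b_2,b_3\}$ induces a triangle of $F$; (Z2) $T_1\cup T_2\cup T_3$ is an induced tree of $F$ minus the three triangle edges, with leaf set $\{b_1,b_2,b_3\}$; (Z3) $a$ is its only degree-3 vertex; (Z4) $F[V(T_2)\cup V(T_3)]$ is a shortest odd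 hole of $F$. A tripod of $F$ is such a triple with $\|T_1\|$ minimum over all triples satisfying Conditions Z in $F$. $F$ is deep if it has a tripod (equivalently, contains a hole $F[V(T_2)\cup V(T_3)]$ for a tripod $T$), non-deep otherwise. -}

module Defs where

open import Data.Nat using (ℕ; zero; suc; _≤_; _<_; parity)
open import Data.Parity.Base using (1ℙ)
open import Data.Bool using (Bool; true; false)
open import Data.Fin using (Fin; toℕ; fromℕ)
open import Data.Fin.Subset using (Subset; _∈_; ∣_∣)
open import Data.List using (List; length)
open import Data.List.Relation.Unary.Unique.Propositional using (Unique)
import Data.List.Membership.Propositional as LM
open import Data.Product using (Σ; Σ-syntax; _×_; _,_)
open import Data.Sum using (_⊎_)
open import Data.Unit using (⊤)
open import Relation.Nullary using (¬_)
open import Relation.Binary.PropositionalEquality using (_≡_; _≢_)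
open import Function.Bundles using (_⇔_)

record Graph (n : ℕ) : Set where
  field
    adj   : Fin n → Fin n → Bool
    sym   : ∀ x y → adj x y ≡ adj y x
    irrefl : ∀ x → adj x x ≡ false
open Graph public

module _ {n : ℕ} where

  -- vertex sets (of subgraphs) are predicates on Fin n
  VSet : Set₁
  VSet = Fin n → Set

  All : VSet
  All _ = ⊤

  Adj : Graph n → Fin n → Fin n → Set
  Adj G x y = adj G x y ≡ true

  Odd : ℕ → Set
  Odd k = parity k ≡ 1ℙ

  -- i and j are consecutive in the cyclic order 0,1,…,k-1,0
  CycNext : {k : ℕ} → Fin k → Fin k → Set
  CycNext {k} i j = (toℕ j ≡ suc (toℕ i)) ⊎ ((toℕ i ≡ 0) × (suc (toℕ j) ≡ k))

  -- Generic paths (distinct vertices, consecutive ones related by E),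
  -- with all vertices in V, from u to v; len = number of edges.

  record GPath (V : VSet) (E : Fin n → Fin n → Set) (u v : Fin n) : Set where
    field
      len  : ℕ
      vtx  : Fin (suc len) → Fin n
      inj  : ∀ i j → vtx i ≡ vtx j → i ≡ j
      inV  : ∀ i → V (vtx i)
      step : ∀ i j → toℕ j ≡ suc (toℕ i) → E (vtx i) (vtx j)
      start : vtx Fin.zero ≡ u
      end   : vtx (fromℕ len) ≡ v
  open GPath public

  OnPath : {V : VSet} {E : Fin n → Fin n → Set} {u v : Fin n} →
           GPath V E u v → Fin n → Set
  OnPath P x = Σ[ i ∈ Fin (suc (len P)) ] vtx P i ≡ x

  PathEdge : {V : VSet} {E : Fin n → Fin n → Set} {u v : Fin n} →
             GPath V E u v → Fin n → Fin n → Set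
  PathEdge P x y = Σ[ i ∈ Fin (suc (len P)) ] Σ[ j ∈ Fin (suc (len P)) ]
    (toℕ j ≡ suc (toℕ i)) × ((vtx P i ≡ x × vtx P j ≡ y) ⊎ (vtx P i ≡ y × vtx P j ≡ x))

  -- a uv-path of F = G[U]
  Path : Graph n → VSet → Fin n → Fin n → Set
  Path G U u v = GPath U (Adj G) u v

  record InducedPath (G : Graph n) (U : VSet) (u v : Fin n) : Set where
    field
      path    : Path G U u v
      induced : ∀ i j → Adj G (vtx path i) (vtx path j) →
                (toℕ j ≡ suc (toℕ i)) ⊎ (toℕ i ≡ suc (toℕ j))
  open InducedPath public

  ipLen : {G : Graph n} {U : VSet} {u v : Fin n} → InducedPath G U u v → ℕ
  ipLen P = len (path P)

  OnIPath : {G : Graph n} {U : VSet} {u v : Fin n} → InducedPath G U u v → Fin n → Set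
  OnIPath P = OnPath (path P)

  -- the vertex set X induces (in G) a uv-path P: P is an induced path
  -- whose vertex set is exactly X
  SpansExactly : {G : Graph n} {U : VSet} {u v : Fin n} → InducedPath G U u v → VSet → Set
  SpansExactly P X = ∀ x → OnIPath P x ⇔ X x

  -- Holes of F = G[U]: induced cycles with at least 4 edges,
  -- given by a cyclic enumeration vtx 0, …, vtx (len-1); len = #edges.

  record Hole (G : Graph n) (U : VSet) : Set where
    field
      hlen   : ℕ
      four≤  : 4 ≤ hlen
      hvtx   : Fin hlen → Fin n
      hinj   : ∀ i j → hvtx i ≡ hvtx j → i ≡ j
      hinU   : ∀ i → U (hvtx i)
      hadj   : ∀ i j → Adj G (hvtx i) (hvtx j) ⇔ (CycNext i j ⊎ CycNext j i)
  open Hole public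

  OnHole : {G : Graph n} {U : VSet} → Hole G U → Fin n → Set
  OnHole C x = Σ[ i ∈ Fin (hlen C) ] hvtx C i ≡ x

  ShortestOddHole : (G : Graph n) (U : VSet) → Hole G U → Set
  ShortestOddHole G U C = Odd (hlen C) × (∀ (C' : Hole G U) → Odd (hlen C') → hlen C ≤ hlen C')

  Dmid : Subset n → Fin n → Fin n → VSet
  Dmid D u v y = (y ∈ D) × (y ≢ u) × (y ≢ v)

  InB : Graph n → VSet → Subset n → Fin n → Fin n → VSet
  InB G U D u v x = U x × x ≢ u × x ≢ v ×
    (Dmid D u v x ⊎ (Σ[ y ∈ Fin n ] Dmid D u v y × Adj G x y))

  record Spade (G : Graph n) (U : VSet) (C : Hole G U) (D : Subset n) : Set where
    field
      u v    : Fin n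
      D⊆U    : ∀ x → x ∈ D → U x
      small  : ∣ D ∣ ≤ 5
      -- (1) C[D] is a uv-path
      CD     : InducedPath G U u v
      CDspan : SpansExactly CD (λ x → OnHole C x × x ∈ D)
      -- (2) F[D] contains an induced uv-path of length ‖C[D]‖ ± 1
      P      : InducedPath G (λ x → x ∈ D) u v
      Plen   : (ipLen P ≡ suc (ipLen CD)) ⊎ (suc (ipLen P) ≡ ipLen CD)
      -- (3) C - B is a shortest uv-path of F - B
      CB     : InducedPath G U u v
      CBspan : SpansExactly CB (λ x → OnHole C x × ¬ InB G U D u v x)
      CBmin  : ∀ (Q : Path G (λ x → U x × ¬ InB G U D u v x) u v) → ipLen CB ≤ len Q
  open Spade public

  Shallow : Graph n → VSet → Set
  Shallow G U = Σ[ C ∈ Hole G U ] ShortestOddHole G U C × (Σ[ D ∈ Subset n ] Spade G U C D)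

  Deg : VSet → (Fin n → Fin n → Set) → Fin n → ℕ → Set
  Deg V E x d = Σ[ ys ∈ List (Fin n) ] Unique ys × (length ys ≡ d) ×
    (∀ y → (y LM.∈ ys) ⇔ (V y × E x y))

  record GCycle (V : VSet) (E : Fin n → Fin n → Set) : Set where
    field
      clen  : ℕ
      three≤ : 3 ≤ clen
      cvtx  : Fin clen → Fin n
      cinj  : ∀ i j → cvtx i ≡ cvtx j → i ≡ j
      cinV  : ∀ i → V (cvtx i)
      cstep : ∀ i j → CycNext i j → E (cvtx i) (cvtx j)

  IsTree : VSet → (Fin n → Fin n → Set) → Set
  IsTree V E = (∀ x y → V x → V y → GPath V E x y) × ¬ GCycle V E

  record ZTriple (G : Graph n) (U : VSet) : Set where
    field
      a b₁ b₂ b₃ : Fin n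
      T₁ : Path G U a b₁
      T₂ : Path G U a b₂
      T₃ : Path G U a b₃
      len₁<len₂ : len T₁ < len T₂
      len₂≤len₃ : len T₂ ≤ len T₃
    X : VSet
    X x = OnPath T₁ x ⊎ OnPath T₂ x ⊎ OnPath T₃ x
    UEdge : Fin n → Fin n → Set
    UEdge x y = PathEdge T₁ x y ⊎ PathEdge T₂ x y ⊎ PathEdge T₃ x y
    IsB : Fin n → Set
    IsB x = x ≡ b₁ ⊎ x ≡ b₂ ⊎ x ≡ b₃
    -- adjacency of F minus the three triangle edges
    Adj' : Fin n → Fin n → Set
    Adj' x y = Adj G x y × ¬ (IsB x × IsB y)
    field
      z1 : Adj G b₁ b₂ × Adj G b₂ b₃ × Adj G b₁ b₃
      -- (Z2) T₁ ∪ T₂ ∪ T₃ is an induced subgraph of F minus the triangle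
      --      edges, is a tree, and has leaf set {b₁,b₂,b₃}
      z2-induced : ∀ x y → X x → X y → UEdge x y ⇔ Adj' x y
      z2-tree    : IsTree X UEdge
      z2-leaves  : ∀ x → X x → Deg X UEdge x 1 ⇔ IsB x
      z3-a    : Deg X UEdge a 3
      z3-only : ∀ x → X x → Deg X UEdge x 3 → x ≡ a
      -- (Z4) F[V(T₂) ∪ V(T₃)] is a shortest odd hole of F
      z4 : Σ[ C ∈ Hole G U ] ShortestOddHole G U C ×
             (∀ x → OnHole C x ⇔ (OnPath T₂ x ⊎ OnPath T₃ x))
  open ZTriple public

  Tripod : Graph n → VSet → Set
  Tripod G U = Σ[ T ∈ ZTriple G U ] (∀ (T' : ZTriple G U) → len (T₁ T) ≤ len (T₁ T'))

  Deep : Graph n → VSet → Set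
  Deep G U = Tripod G U

  Connected : Graph n → Set
  Connected G = ∀ x y → Path G All x y

  HasHoleOfLength : Graph n → ℕ → Set
  HasHoleOfLength G k = Σ[ C ∈ Hole G All ] hlen C ≡ k

-- Every shortest odd hole of H is a shortest odd hole of G, because H contains one of G. Hence a triple
-- satisfying Conditions Z in H satisfies them in G, and a minimal one is a tripod of G. Likewise a shallow
-- hole C of H with spade D is a shortest odd hole of G, and D is a spade for it in G unless G − B has a
-- uv-path Q shorter than C − B. Take Q shortest, hence induced; its interior avoids D ∖ {u, v} and all its
-- neighbours, so gluing Q to C[D] and to the induced uv-path P of G[D] gives two holes of G. Counting
-- vertices of C gives ‖C − B‖ + ‖C[D]‖ ≤ |C|, so Q ∪ C[D] is shorter than C and Q ∪ P is no longer than C.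
-- As their lengths differ by one, either one of them is an odd hole shorter than C, or Q ∪ P is an odd
-- hole of length |C|, which is shallow in G with spade D.

module Submission where

open import Defs hiding (sym)
open import Data.Nat using (ℕ; zero; suc; _+_; _∸_; _≤_; _<_; z≤n; s≤s; _≤?_; _≟_)
open import Data.Nat.Properties
open import Data.Nat.Induction using (<-rec)
open import Data.Fin as Fin using (Fin; toℕ; fromℕ; fromℕ<)
open import Data.Fin.Properties using (toℕ-injective; toℕ-fromℕ; toℕ-fromℕ<; toℕ≤pred[n]; toℕ<n; injective⇒≤)
open import Data.Fin.Subset using (Subset; _∈_)
open import Data.Product using (Σ-syntax; _×_; _,_; proj₁; proj₂)
open import Data.Sum using (_⊎_; inj₁; inj₂; swap; [_,_])
open import Data.Empty using (⊥; ⊥-elim)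
open import Data.Unit using (tt)
open import Relation.Nullary using (¬_; yes; no)
open import Relation.Nullary.Decidable using (decidable-stable)
open import Relation.Binary.PropositionalEquality hiding ([_])
open import Relation.Binary.Definitions using (tri<; tri≈; tri>)
open import Function.Bundles using (_⇔_; mk⇔; module Equivalence)
open Equivalence using (to; from)
open import Function.Base using (id)

clamp : (m : ℕ) → ℕ → Fin (suc m)
clamp m       zero    = Fin.zero
clamp zero    (suc k) = Fin.zero
clamp (suc m) (suc k) = Fin.suc (clamp m k)

toℕ-clamp : ∀ m k → k ≤ m → toℕ (clamp m k) ≡ k
toℕ-clamp m       zero    _         = refl
toℕ-clamp (suc m) (suc k) (s≤s k≤m) = cong suc (toℕ-clamp m k k≤m)

clamp-toℕ : ∀ m (i : Fin (suc m)) → clamp m (toℕ i) ≡ i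
clamp-toℕ m       Fin.zero    = refl
clamp-toℕ (suc m) (Fin.suc i) = cong Fin.suc (clamp-toℕ m i)

module _ {a} {X : Set a} where

  splice : ℕ → (ℕ → X) → (ℕ → X) → ℕ → X
  splice A f g k with k ≤? A
  ... | yes _ = f k
  ... | no  _ = g k

  module Splice (A : ℕ) (f g : ℕ → X) where

    splice-cases : ∀ k → (k ≤ A × splice A f g k ≡ f k) ⊎ (A < k × splice A f g k ≡ g k)
    splice-cases k with k ≤? A
    ... | yes k≤A = inj₁ (k≤A , refl)
    ... | no  k≰A = inj₂ (≰⇒> k≰A , refl)

    splice-≤ : ∀ {k} → k ≤ A → splice A f g k ≡ f k
    splice-≤ {k} k≤A with splice-cases k
    ... | inj₁ (_ , e)   = e
    ... | inj₂ (A<k , _) = ⊥-elim (<⇒≱ A<k k≤A)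

    splice-> : ∀ {k} → A < k → splice A f g k ≡ g k
    splice-> {k} A<k with splice-cases k
    ... | inj₁ (k≤A , _) = ⊥-elim (<⇒≱ A<k k≤A)
    ... | inj₂ (_ , e)   = e

    splice-preserves : ∀ {p} (P : X → Set p) → (∀ k → P (f k)) → (∀ k → P (g k)) → ∀ k → P (splice A f g k)
    splice-preserves P Pf Pg k with splice-cases k
    ... | inj₁ (_ , e) = subst P (sym e) (Pf k)
    ... | inj₂ (_ , e) = subst P (sym e) (Pg k)

    splice-injective : ∀ {m} →
      (∀ j k → j ≤ A → k ≤ A → f j ≡ f k → j ≡ k) →
      (∀ j k → A < j → j < m → A < k → k < m → g j ≡ g k → j ≡ k) →
      (∀ j k → j ≤ A → A < k → k < m → f j ≢ g k) →
      ∀ j k → j < m → k < m → splice A f g j ≡ splice A f g k → j ≡ k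
    splice-injective f-inj g-inj disjoint j k j<m k<m e with splice-cases j | splice-cases k
    ... | inj₁ (j≤A , ej) | inj₁ (k≤A , ek) = f-inj j k j≤A k≤A (trans (sym ej) (trans e ek))
    ... | inj₂ (A<j , ej) | inj₂ (A<k , ek) = g-inj j k A<j j<m A<k k<m (trans (sym ej) (trans e ek))
    ... | inj₁ (j≤A , ej) | inj₂ (A<k , ek) = ⊥-elim (disjoint j k j≤A A<k k<m (trans (sym ej) (trans e ek)))
    ... | inj₂ (A<j , ej) | inj₁ (k≤A , ek) = ⊥-elim (disjoint k j k≤A A<j j<m (trans (sym ek) (trans (sym e) ej)))

¬¬-argmin : ∀ {a} {A : Set a} (μ : A → ℕ) → A → ¬ ¬ (Σ[ x ∈ A ] ∀ y → μ x ≤ μ y)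
¬¬-argmin μ x no-argmin = <-rec (λ k → ∀ x → μ x ≡ k → ⊥) descend (μ x) x refl
  where
  descend : ∀ k → (∀ {j} → j < k → ∀ x → μ x ≡ j → ⊥) → ∀ x → μ x ≡ k → ⊥
  descend _ below x refl = no-argmin (x , λ y →
    decidable-stable (μ x ≤? μ y) (λ x≰y → below (≰⇒> x≰y) y refl))

module _ {n : ℕ} {V : VSet {n}} {E : Fin n → Fin n → Set} {u v : Fin n} (P : GPath V E u v) where

  at : ℕ → Fin n
  at k = vtx P (clamp (len P) k)

  at-toℕ : ∀ i → at (toℕ i) ≡ vtx P i
  at-toℕ i = cong (vtx P) (clamp-toℕ (len P) i)

  at-injective : ∀ j k → j ≤ len P → k ≤ len P → at j ≡ at k → j ≡ k
  at-injective j k j≤ k≤ e =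
    trans (sym (toℕ-clamp _ j j≤)) (trans (cong toℕ (inj P _ _ e)) (toℕ-clamp _ k k≤))

  at-step : ∀ k → k < len P → E (at k) (at (suc k))
  at-step k k< = step P _ _ (trans (toℕ-clamp _ (suc k) k<) (cong suc (sym (toℕ-clamp _ k (<⇒≤ k<)))))

  at-inV : ∀ k → V (at k)
  at-inV k = inV P _

  at-start : at 0 ≡ u
  at-start = start P

  at-end : at (len P) ≡ v
  at-end = trans (cong (vtx P) (toℕ-injective (trans (toℕ-clamp _ _ ≤-refl) (sym (toℕ-fromℕ _))))) (end P)

  OnPath⇒at : ∀ {x} → OnPath P x → Σ[ k ∈ ℕ ] k ≤ len P × at k ≡ x
  OnPath⇒at (i , e) = toℕ i , toℕ≤pred[n] i , trans (at-toℕ i) e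

  at⇒OnPath : ∀ k → OnPath P (at k)
  at⇒OnPath k = clamp (len P) k , refl

  at-interior-≢-start : ∀ k → 0 < k → k ≤ len P → at k ≢ u
  at-interior-≢-start k 0<k k≤ e = <⇒≢ 0<k (sym (at-injective k 0 k≤ z≤n (trans e (sym at-start))))

  at-interior-≢-end : ∀ k → k < len P → at k ≢ v
  at-interior-≢-end k k< e = <⇒≢ k< (at-injective k (len P) (<⇒≤ k<) ≤-refl (trans e (sym at-end)))

  ends-OnPath : ∀ {x} → x ≡ u ⊎ x ≡ v → OnPath P x
  ends-OnPath (inj₁ x≡u) = Fin.zero , trans (start P) (sym x≡u)
  ends-OnPath (inj₂ x≡v) = fromℕ (len P) , trans (end P) (sym x≡v)

  closed⇒len≡0 : u ≡ v → len P ≡ 0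
  closed⇒len≡0 u≡v = sym (at-injective 0 (len P) z≤n ≤-refl (trans at-start (trans u≡v (sym at-end))))

module _ {n : ℕ} {V : VSet {n}} {E : Fin n → Fin n → Set} {u v : Fin n} where

  mkGPath : (L : ℕ) (f : ℕ → Fin n) →
    (∀ j k → j ≤ L → k ≤ L → f j ≡ f k → j ≡ k) →
    (∀ k → V (f k)) →
    (∀ k → k < L → E (f k) (f (suc k))) →
    f 0 ≡ u → f L ≡ v → GPath V E u v
  mkGPath L f f-inj f-inV f-step f0 fL = record
    { len   = L
    ; vtx   = λ i → f (toℕ i)
    ; inj   = λ i j e → toℕ-injective (f-inj _ _ (toℕ≤pred[n] i) (toℕ≤pred[n] j) e)
    ; inV   = λ i → f-inV (toℕ i)
    ; step  = λ i j e → subst (λ z → E (f (toℕ i)) (f z)) (sym e)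
                          (f-step _ (subst (_≤ L) e (toℕ≤pred[n] j)))
    ; start = f0
    ; end   = trans (cong f (toℕ-fromℕ L)) fL
    }

module _ {n : ℕ} (G : Graph n) where

  Adj-irrefl : ∀ x → ¬ Adj G x x
  Adj-irrefl x e with trans (sym (irrefl G x)) e
  ... | ()

  Adj-sym : ∀ {x y} → Adj G x y → Adj G y x
  Adj-sym {x} {y} e = trans (Graph.sym G y x) e

  at-induced : ∀ {U u v} (P : InducedPath G U u v) j k → j ≤ ipLen P → k ≤ ipLen P →
    Adj G (at (path P) j) (at (path P) k) → (k ≡ suc j) ⊎ (j ≡ suc k)
  at-induced P j k j≤ k≤ e with induced P (clamp _ j) (clamp _ k) e
  ... | inj₁ c = inj₁ (trans (sym (toℕ-clamp _ k k≤)) (trans c (cong suc (toℕ-clamp _ j j≤))))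
  ... | inj₂ c = inj₂ (trans (sym (toℕ-clamp _ j j≤)) (trans c (cong suc (toℕ-clamp _ k k≤))))

  adjacent-ends⇒ipLen≡1 : ∀ {U u v} (P : InducedPath G U u v) → Adj G u v → ipLen P ≡ 1
  adjacent-ends⇒ipLen≡1 P e
    with at-induced P 0 (ipLen P) z≤n ≤-refl (subst₂ (Adj G) (sym (at-start (path P))) (sym (at-end (path P))) e)
  ... | inj₁ len≡1 = len≡1

  2≤len : ∀ {U u v} (P : Path G U u v) → u ≢ v → ¬ Adj G u v → 2 ≤ len P
  2≤len P u≢v u≁v with len P in eq
  ... | 0     = ⊥-elim (u≢v (trans (sym (at-start P)) (trans (cong (at P) (sym eq)) (at-end P))))
  ... | 1     = ⊥-elim (u≁v (subst₂ (Adj G) (at-start P) (trans (cong (at P) (sym eq)) (at-end P))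
                  (at-step P 0 (subst (0 <_) (sym eq) (s≤s z≤n)))))
  ... | suc (suc _) = s≤s (s≤s z≤n)

  -- Skips the d vertices strictly between positions a and a + d + 1, which a chord joins.
  module Shortcut {S : VSet {n}} {u v} (Q : Path G S u v) (a d : ℕ) (1≤d : 1 ≤ d)
                  (a+d<len : suc (a + d) ≤ len Q) (chord : Adj G (at Q a) (at Q (suc (a + d)))) where

    L′ : ℕ
    L′ = len Q ∸ d

    L′+d≡len : L′ + d ≡ len Q
    L′+d≡len = m∸n+n≡m (≤-trans (m≤n+m d a) (≤-trans (n≤1+n _) a+d<len))

    a<L′ : a < L′
    a<L′ = +-cancelʳ-≤ d (suc a) L′ (subst (suc a + d ≤_) (sym L′+d≡len) a+d<len)

    a≤len : a ≤ len Q
    a≤len = ≤-trans (<⇒≤ a<L′) (m∸n≤m (len Q) d)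

    shifted≤len : ∀ k → k ≤ L′ → k + d ≤ len Q
    shifted≤len k k≤ = subst (k + d ≤_) L′+d≡len (+-monoˡ-≤ d k≤)

    hi : ℕ → Fin n
    hi k = at Q (k + d)

    sc : ℕ → Fin n
    sc = splice a (at Q) hi

    open Splice a (at Q) hi

    sc-injective : ∀ j k → j ≤ L′ → k ≤ L′ → sc j ≡ sc k → j ≡ k
    sc-injective j k j≤ k≤ = splice-injective
      (λ j k j≤a k≤a → at-injective Q j k (≤-trans j≤a a≤len) (≤-trans k≤a a≤len))
      (λ j k _ j< _ k< e → +-cancelʳ-≡ d j k
         (at-injective Q _ _ (shifted≤len j (≤-pred j<)) (shifted≤len k (≤-pred k<)) e))
      (λ j k j≤a a<k k< e → <⇒≱ (<-≤-trans a<k (m≤m+n k d))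
         (≤-trans (≤-reflexive (sym (at-injective Q j (k + d) (≤-trans j≤a a≤len) (shifted≤len k (≤-pred k<)) e))) j≤a))
      j k (s≤s j≤) (s≤s k≤)

    sc-step : ∀ k → k < L′ → Adj G (sc k) (sc (suc k))
    sc-step k k< with splice-cases k | splice-cases (suc k)
    ... | inj₁ (_ , e) | inj₁ (1+k≤a , e′) = subst₂ (Adj G) (sym e) (sym e′) (at-step Q k (≤-trans 1+k≤a a≤len))
    ... | inj₁ (k≤a , e) | inj₂ (a<1+k , e′) =
      subst₂ (Adj G) (sym e) (sym e′) (subst (λ i → Adj G (at Q i) (at Q (suc (i + d)))) (≤-antisym (≤-pred a<1+k) k≤a) chord)
    ... | inj₂ (a<k , _) | inj₁ (1+k≤a , _) = ⊥-elim (<-asym a<k 1+k≤a)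
    ... | inj₂ (_ , e) | inj₂ (_ , e′) = subst₂ (Adj G) (sym e) (sym e′)
      (at-step Q (k + d) (subst (k + d <_) L′+d≡len (+-monoˡ-< d k<)))

    shortcut : Path G S u v
    shortcut = mkGPath L′ sc sc-injective
      (splice-preserves S (at-inV Q) (λ k → at-inV Q (k + d)))
      sc-step
      (trans (splice-≤ z≤n) (at-start Q))
      (trans (splice-> a<L′) (trans (cong (at Q) L′+d≡len) (at-end Q)))

    shortcut-shorter : len shortcut < len Q
    shortcut-shorter = subst (L′ <_) L′+d≡len (subst (_≤ L′ + d) (+-comm L′ 1) (+-monoʳ-≤ L′ 1≤d))

  module _ {S : VSet {n}} {u v} (Q : Path G S u v) (shortest : ∀ (R : Path G S u v) → len Q ≤ len R) where

    shortest-chordless : ∀ j k → suc j < k → k ≤ len Q → ¬ Adj G (at Q j) (at Q k)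
    shortest-chordless j k 1+j<k k≤ chord with k ∸ suc j | m+[n∸m]≡n (<⇒≤ 1+j<k) | m<n⇒0<n∸m 1+j<k
    ... | d | refl | 1≤d = <⇒≱ (Shortcut.shortcut-shorter Q j d 1≤d k≤ chord) (shortest (Shortcut.shortcut Q j d 1≤d k≤ chord))

    shortest⇒induced : ∀ j k → j ≤ len Q → k ≤ len Q → Adj G (at Q j) (at Q k) → (k ≡ suc j) ⊎ (j ≡ suc k)
    shortest⇒induced j k j≤ k≤ e with <-cmp j k
    ... | tri≈ _ refl _ = ⊥-elim (Adj-irrefl _ e)
    ... | tri< j<k _ _  = inj₁ (≤-antisym (≮⇒≥ λ 1+j<k → shortest-chordless j k 1+j<k k≤ e) j<k)
    ... | tri> _ _ k<j  = inj₂ (≤-antisym (≮⇒≥ λ 1+k<j → shortest-chordless k j 1+k<j j≤ (Adj-sym e)) k<j)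

    shortest⇒InducedPath : InducedPath G S u v
    shortest⇒InducedPath = record
      { path    = Q
      ; induced = λ i j e → shortest⇒induced (toℕ i) (toℕ j) (toℕ≤pred[n] i) (toℕ≤pred[n] j)
                              (subst₂ (Adj G) (sym (at-toℕ Q i)) (sym (at-toℕ Q j)) e)
      }

  -- The cyclic sequence runs along R₁ from u to v and then back along R₂.
  module Glue {V₁ V₂ : VSet {n}} {u v : Fin n}
    (R₁ : InducedPath G V₁ u v) (R₂ : InducedPath G V₂ u v) (u≢v : u ≢ v) (u≁v : ¬ Adj G u v)
    (disjoint : ∀ i j → 0 < i → i < ipLen R₁ → 0 < j → j < ipLen R₂ → at (path R₁) i ≢ at (path R₂) j)
    (anticomplete : ∀ i j → 0 < i → i < ipLen R₁ → 0 < j → j < ipLen R₂ →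
                    ¬ Adj G (at (path R₁) i) (at (path R₂) j))
    where

    A B m : ℕ
    A = ipLen R₁
    B = ipLen R₂
    m = A + B

    g h back : ℕ → Fin n
    g = at (path R₁)
    h = at (path R₂)
    back k = h (m ∸ k)

    cyc : ℕ → Fin n
    cyc = splice A g back

    open Splice A g back

    2≤B : 2 ≤ B
    2≤B = 2≤len (path R₂) u≢v u≁v

    A<m : A < m
    A<m = subst (_≤ m) (+-comm A 1) (+-monoʳ-≤ A (≤-trans (s≤s z≤n) 2≤B))

    back-index : ∀ {k} → A < k → k < m → m ∸ k < B
    back-index {k} A<k k<m = subst (m ∸ k <_) (m+n∸m≡n A B) (∸-monoʳ-< A<k (<⇒≤ k<m))

    g0≡h0 : g 0 ≡ h 0
    g0≡h0 = trans (at-start (path R₁)) (sym (at-start (path R₂)))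

    gA≡hB : g A ≡ h B
    gA≡hB = trans (at-end (path R₁)) (sym (at-end (path R₂)))

    data Position (k : ℕ) : Set where
      on₁ : k ≤ A → cyc k ≡ g k → Position k
      on₂ : ∀ j → 0 < j → j < B → j + k ≡ m → cyc k ≡ h j → Position k

    position : ∀ k → k < m → Position k
    position k k<m with splice-cases k
    ... | inj₁ (k≤A , e) = on₁ k≤A e
    ... | inj₂ (A<k , e) = on₂ (m ∸ k) (m<n⇒0<n∸m k<m) (back-index A<k k<m) (m∸n+n≡m (<⇒≤ k<m)) e

    cyc≡h : ∀ k j → A ≤ k → j + k ≡ m → cyc k ≡ h j
    cyc≡h k j A≤k e with m≤n⇒m<n∨m≡n A≤k
    ... | inj₂ refl = trans (splice-≤ ≤-refl) (trans gA≡hB (cong h (+-cancelʳ-≡ A B j (trans (+-comm B A) (sym e)))))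
    ... | inj₁ A<k  = trans (splice-> A<k)
      (cong h (+-cancelʳ-≡ k (m ∸ k) j (trans (m∸n+n≡m (≤-trans (m≤n+m k j) (≤-reflexive e))) (sym e))))

    interior₂-∉R₁ : ∀ i j → i ≤ A → 0 < j → j < B → g i ≢ h j
    interior₂-∉R₁ zero    j _ 0<j j<B e = <⇒≢ 0<j (at-injective (path R₂) 0 j z≤n (<⇒≤ j<B) (trans (sym g0≡h0) e))
    interior₂-∉R₁ (suc i) j 1+i≤A 0<j j<B e with suc i ≟ A
    ... | yes 1+i≡A = <⇒≢ j<B (at-injective (path R₂) j B (<⇒≤ j<B) ≤-refl (trans (sym e) (trans (cong g 1+i≡A) gA≡hB)))
    ... | no  1+i≢A = disjoint (suc i) j (s≤s z≤n) (≤∧≢⇒< 1+i≤A 1+i≢A) 0<j j<B e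

    cyc-injective : ∀ j k → j < m → k < m → cyc j ≡ cyc k → j ≡ k
    cyc-injective = splice-injective
      (at-injective (path R₁))
      (λ j k A<j j<m A<k k<m e → ∸-cancelˡ-≡ (<⇒≤ j<m) (<⇒≤ k<m)
         (at-injective (path R₂) _ _ (<⇒≤ (back-index A<j j<m)) (<⇒≤ (back-index A<k k<m)) e))
      (λ j k j≤A A<k k<m → interior₂-∉R₁ j (m ∸ k) j≤A (m<n⇒0<n∸m k<m) (back-index A<k k<m))

    Consecutive : ℕ → ℕ → Set
    Consecutive j k = (k ≡ suc j) ⊎ ((j ≡ 0) × (suc k ≡ m))

    complement-≤ : ∀ {j k} → j + k ≡ m → A ≤ k → j ≤ B
    complement-≤ {j} {k} e A≤k = +-cancelʳ-≤ A j B (subst (j + A ≤_) (trans e (+-comm A B)) (+-monoʳ-≤ j A≤k))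

    complement-> : ∀ {j k} → j < B → j + k ≡ m → A < k
    complement-> {j} {k} j<B e = +-cancelˡ-< B A k (subst (_< B + k) (trans e (+-comm A B)) (+-monoˡ-< k j<B))

    complement-suc : ∀ {j₁ k₁ j₂ k₂} → j₁ + k₁ ≡ m → j₂ + k₂ ≡ m → j₂ ≡ suc j₁ → k₁ ≡ suc k₂
    complement-suc {j₁} {k₁} {j₂} {k₂} e₁ e₂ refl =
      +-cancelˡ-≡ j₁ k₁ (suc k₂) (trans e₁ (trans (sym e₂) (sym (+-suc j₁ k₂))))

    consecutive⇒adjacent : ∀ j k → j < m → k < m → Consecutive j k → Adj G (cyc j) (cyc k)
    consecutive⇒adjacent j .(suc j) _ 1+j<m (inj₁ refl) with position (suc j) 1+j<m
    ... | on₁ 1+j≤A e = subst₂ (Adj G) (sym (splice-≤ (≤-trans (n≤1+n j) 1+j≤A))) (sym e) (at-step (path R₁) j 1+j≤A)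
    ... | on₂ i _ i<B s e = Adj-sym (subst₂ (Adj G) (sym e) (sym (cyc≡h j (suc i) A≤j s′))
                                       (at-step (path R₂) i (complement-≤ s′ A≤j)))
      where
      s′ : suc i + j ≡ m
      s′ = trans (sym (+-suc i j)) s
      A≤j : A ≤ j
      A≤j = ≤-pred (complement-> i<B s)
    consecutive⇒adjacent .0 k _ k<m (inj₂ (refl , e)) =
      subst₂ (Adj G) (sym (trans (splice-≤ z≤n) g0≡h0)) (sym (cyc≡h k 1 (≤-pred (subst (suc A ≤_) (sym e) A<m)) e))
        (at-step (path R₂) 0 (≤-trans (s≤s z≤n) 2≤B))

    adjacent-across : ∀ i k → i ≤ A → ∀ j → 0 < j → j < B → j + k ≡ m → Adj G (g i) (h j) →
                      Consecutive i k ⊎ Consecutive k i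
    adjacent-across zero k _ j _ j<B s e with at-induced R₂ 0 j z≤n (<⇒≤ j<B) (subst (λ z → Adj G z (h j)) g0≡h0 e)
    ... | inj₁ refl = inj₁ (inj₂ (refl , s))
    adjacent-across (suc i) k 1+i≤A j 0<j j<B s e with suc i ≟ A
    ... | no 1+i≢A = ⊥-elim (anticomplete (suc i) j (s≤s z≤n) (≤∧≢⇒< 1+i≤A 1+i≢A) 0<j j<B e)
    ... | yes 1+i≡A with at-induced R₂ B j ≤-refl (<⇒≤ j<B) (subst (λ z → Adj G z (h j)) (trans (cong g 1+i≡A) gA≡hB) e)
    ...   | inj₁ j≡1+B = ⊥-elim (<⇒≱ j<B (≤-trans (n≤1+n B) (≤-reflexive (sym j≡1+B))))
    ...   | inj₂ B≡1+j = inj₁ (inj₁ (trans (complement-suc s (+-comm B A) B≡1+j) (cong suc (sym 1+i≡A))))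

    adjacent⇒consecutive : ∀ j k → j < m → k < m → Adj G (cyc j) (cyc k) → Consecutive j k ⊎ Consecutive k j
    adjacent⇒consecutive j k j<m k<m e with position j j<m | position k k<m
    ... | on₁ j≤A ej | on₁ k≤A ek with at-induced R₁ j k j≤A k≤A (subst₂ (Adj G) ej ek e)
    ...   | inj₁ c = inj₁ (inj₁ c)
    ...   | inj₂ c = inj₂ (inj₁ c)
    adjacent⇒consecutive j k j<m k<m e | on₂ i _ i<B si ej | on₂ l _ l<B sl ek
      with at-induced R₂ i l (<⇒≤ i<B) (<⇒≤ l<B) (subst₂ (Adj G) ej ek e)
    ...   | inj₁ c = inj₂ (inj₁ (complement-suc si sl c))
    ...   | inj₂ c = inj₁ (inj₁ (complement-suc sl si c))
    adjacent⇒consecutive j k j<m k<m e | on₁ j≤A ej | on₂ l 0<l l<B sl ek =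
      adjacent-across j k j≤A l 0<l l<B sl (subst₂ (Adj G) ej ek e)
    adjacent⇒consecutive j k j<m k<m e | on₂ i 0<i i<B si ej | on₁ k≤A ek =
      swap (adjacent-across k j k≤A i 0<i i<B si (subst₂ (Adj G) ek ej (Adj-sym e)))

    hole : Hole G All
    hole = record
      { hlen  = m
      ; four≤ = +-mono-≤ (2≤len (path R₁) u≢v u≁v) 2≤B
      ; hvtx  = λ i → cyc (toℕ i)
      ; hinj  = λ i j e → toℕ-injective (cyc-injective _ _ (toℕ<n i) (toℕ<n j) e)
      ; hinU  = λ _ → tt
      ; hadj  = λ i j → mk⇔ (adjacent⇒consecutive _ _ (toℕ<n i) (toℕ<n j))
                  λ { (inj₁ c) → consecutive⇒adjacent _ _ (toℕ<n i) (toℕ<n j) c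
                    ; (inj₂ c) → Adj-sym (consecutive⇒adjacent _ _ (toℕ<n j) (toℕ<n i) c) }
      }

    cyc-on-hole : ∀ k → k < m → OnHole hole (cyc k)
    cyc-on-hole k k<m = fromℕ< k<m , cong cyc (toℕ-fromℕ< k<m)

    R₁-on-hole : ∀ k → k ≤ A → OnHole hole (g k)
    R₁-on-hole k k≤A = subst (OnHole hole) (splice-≤ k≤A) (cyc-on-hole k (≤-<-trans k≤A A<m))

    R₂-on-hole : ∀ j → j ≤ B → OnHole hole (h j)
    R₂-on-hole zero    _     = subst (OnHole hole) g0≡h0 (R₁-on-hole 0 z≤n)
    R₂-on-hole (suc j) 1+j≤B = subst (OnHole hole) (cyc≡h (m ∸ suc j) (suc j) A≤m∸1+j (m+[n∸m]≡n 1+j≤m))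
      (cyc-on-hole (m ∸ suc j) (∸-monoʳ-< {m} {suc j} {0} (s≤s z≤n) 1+j≤m))
      where
      1+j≤m : suc j ≤ m
      1+j≤m = ≤-trans 1+j≤B (m≤n+m B A)
      A≤m∸1+j : A ≤ m ∸ suc j
      A≤m∸1+j = subst (_≤ m ∸ suc j) (m+n∸n≡m A B) (∸-monoʳ-≤ m 1+j≤B)

    OnHole-hole : ∀ x → OnHole hole x ⇔ (OnIPath R₁ x ⊎ OnIPath R₂ x)
    OnHole-hole x = mk⇔ on-hole⇒on-paths on-paths⇒on-hole
      where
      on-hole⇒on-paths : OnHole hole x → OnIPath R₁ x ⊎ OnIPath R₂ x
      on-hole⇒on-paths (i , e) with position (toℕ i) (toℕ<n i)
      ... | on₁ _ eᵢ        = inj₁ (subst (OnPath (path R₁)) (trans (sym eᵢ) e) (at⇒OnPath (path R₁) (toℕ i)))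
      ... | on₂ j _ _ _ eᵢ  = inj₂ (subst (OnPath (path R₂)) (trans (sym eᵢ) e) (at⇒OnPath (path R₂) j))
      on-paths⇒on-hole : OnIPath R₁ x ⊎ OnIPath R₂ x → OnHole hole x
      on-paths⇒on-hole (inj₁ o) with OnPath⇒at (path R₁) o
      ... | k , k≤ , e = subst (OnHole hole) e (R₁-on-hole k k≤)
      on-paths⇒on-hole (inj₂ o) with OnPath⇒at (path R₂) o
      ... | k , k≤ , e = subst (OnHole hole) e (R₂-on-hole k k≤)

  injective-on-hole⇒≤ : ∀ {U} (C : Hole G U) m (f : ℕ → Fin n) → (∀ k → OnHole C (f k)) →
    (∀ j k → j < m → k < m → f j ≡ f k → j ≡ k) → m ≤ hlen C
  injective-on-hole⇒≤ C m f on-C f-inj = injective⇒≤ {f = position} position-injective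
    where
    position : Fin m → Fin (hlen C)
    position i = proj₁ (on-C (toℕ i))
    position-injective : ∀ {i j} → position i ≡ position j → i ≡ j
    position-injective {i} {j} e = toℕ-injective (f-inj _ _ (toℕ<n i) (toℕ<n j)
      (trans (sym (proj₂ (on-C (toℕ i)))) (trans (cong (hvtx C) e) (proj₂ (on-C (toℕ j))))))

  module _ {U : VSet {n}} {C : Hole G U} {D : Subset n} (sp : Spade G U C D) where

    private
      lengths-differ : ipLen (Spade.P sp) ≢ ipLen (Spade.CD sp)
      lengths-differ p≡l with Spade.Plen sp
      ... | inj₁ e = 1+n≢n (trans (sym e) p≡l)
      ... | inj₂ e = 1+n≢n (trans (cong suc (sym p≡l)) e)

    spade-ends-distinct : Spade.u sp ≢ Spade.v sp
    spade-ends-distinct u≡v = lengths-differ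
      (trans (closed⇒len≡0 (path (Spade.P sp)) u≡v) (sym (closed⇒len≡0 (path (Spade.CD sp)) u≡v)))

    spade-ends-nonadjacent : ¬ Adj G (Spade.u sp) (Spade.v sp)
    spade-ends-nonadjacent u∼v = lengths-differ
      (trans (adjacent-ends⇒ipLen≡1 (Spade.P sp) u∼v) (sym (adjacent-ends⇒ipLen≡1 (Spade.CD sp) u∼v)))

odd⊎odd-suc : ∀ {n} k → Odd {n} k ⊎ Odd {n} (suc k)
odd⊎odd-suc     zero          = inj₂ refl
odd⊎odd-suc     (suc zero)    = inj₁ refl
odd⊎odd-suc {n} (suc (suc k)) = odd⊎odd-suc {n} k

module _ {n : ℕ} where

  pathIn : ∀ {V V′ : VSet {n}} {E u v} (P : GPath V E u v) → (∀ i → V′ (vtx P i)) → GPath V′ E u v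
  pathIn P inV′ = record { len = len P ; vtx = vtx P ; inj = inj P ; inV = inV′ ; step = step P ; start = start P ; end = end P }

  inducedPathIn : ∀ {G : Graph n} {U U′ : VSet {n}} {u v} (P : InducedPath G U u v) →
    (∀ i → U′ (vtx (path P) i)) → InducedPath G U′ u v
  inducedPathIn P inU′ = record { path = pathIn (path P) inU′ ; induced = induced P }

  holeIn : ∀ {G : Graph n} {U U′ : VSet {n}} (C : Hole G U) → (∀ i → U′ (hvtx C i)) → Hole G U′
  holeIn C inU′ = record { hlen = hlen C ; four≤ = four≤ C ; hvtx = hvtx C ; hinj = hinj C ; hinU = inU′ ; hadj = hadj C }

module _ {n : ℕ} (G : Graph n) (W : Subset n)
         (C₀ : Hole G All) (C₀-shortest : ShortestOddHole G All C₀) (C₀⊆W : ∀ i → hvtx C₀ i ∈ W) where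

  H : VSet {n}
  H x = x ∈ W

  shortestOddHole-lift : ∀ C → ShortestOddHole G H C → ShortestOddHole G All (holeIn C (λ _ → tt))
  shortestOddHole-lift C (C-odd , C-min) = C-odd , λ C′ C′-odd →
    ≤-trans (C-min (holeIn C₀ C₀⊆W) (proj₁ C₀-shortest)) (proj₂ C₀-shortest C′ C′-odd)

  zTriple-lift : ZTriple G H → ZTriple G All
  zTriple-lift T = record
    { a = a T ; b₁ = b₁ T ; b₂ = b₂ T ; b₃ = b₃ T
    ; T₁ = pathIn (T₁ T) (λ _ → tt)
    ; T₂ = pathIn (T₂ T) (λ _ → tt)
    ; T₃ = pathIn (T₃ T) (λ _ → tt)
    ; len₁<len₂  = len₁<len₂ T
    ; len₂≤len₃  = len₂≤len₃ T
    ; z1         = z1 T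
    ; z2-induced = z2-induced T
    ; z2-tree    = z2-tree T
    ; z2-leaves  = z2-leaves T
    ; z3-a       = z3-a T
    ; z3-only    = z3-only T
    ; z4         = let (C , C-shortest , C≡T₂∪T₃) = z4 T in
                   holeIn C (λ _ → tt) , shortestOddHole-lift C C-shortest , C≡T₂∪T₃
    }

  nonDeep-restrict : ¬ Deep G All → ¬ Deep G H
  nonDeep-restrict not-deep (T , _) = ¬¬-argmin (λ T → len (T₁ T)) (zTriple-lift T) not-deep

  module SpadeLift (not-shallow : ¬ Shallow G All) (C : Hole G H) (C-shortest : ShortestOddHole G H C)
                   {D : Subset n} (sp : Spade G H C D) where

    u′ v′ : Fin n
    u′ = Spade.u sp
    v′ = Spade.v sp

    C[D] C∖B : InducedPath G H u′ v′
    C[D] = Spade.CD sp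
    C∖B  = Spade.CB sp

    P′ : InducedPath G (_∈ D) u′ v′
    P′ = Spade.P sp

    l p L : ℕ
    l = ipLen C[D]
    p = ipLen P′
    L = ipLen C∖B

    -- B is the set B of the spade computed in H, B⁺ the same set computed in G.
    B⁺ B : VSet {n}
    B⁺ = InB G All D u′ v′
    B  = InB G H D u′ v′

    OutsideB⁺ : VSet {n}
    OutsideB⁺ x = All x × ¬ B⁺ x

    C-odd-min : ∀ (C′ : Hole G All) → Odd {n} (hlen C′) → hlen C ≤ hlen C′
    C-odd-min = proj₂ (shortestOddHole-lift C C-shortest)

    C[D]-in-D : ∀ k → at (path C[D]) k ∈ D
    C[D]-in-D k = proj₂ (to (Spade.CDspan sp (at (path C[D]) k)) (at⇒OnPath (path C[D]) k))

    C[D]-on-C : ∀ k → OnHole C (at (path C[D]) k)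
    C[D]-on-C k = proj₁ (to (Spade.CDspan sp (at (path C[D]) k)) (at⇒OnPath (path C[D]) k))

    C∖B-on-C : ∀ k → OnHole C (at (path C∖B) k)
    C∖B-on-C k = proj₁ (to (Spade.CBspan sp (at (path C∖B) k)) (at⇒OnPath (path C∖B) k))

    C∖B-∉B : ∀ k → ¬ B (at (path C∖B) k)
    C∖B-∉B k = proj₂ (to (Spade.CBspan sp (at (path C∖B) k)) (at⇒OnPath (path C∖B) k))

    interior-Dmid : ∀ {V} (R : InducedPath G V u′ v′) → (∀ k → at (path R) k ∈ D) →
                    ∀ k → 0 < k → k < ipLen R → Dmid D u′ v′ (at (path R) k)
    interior-Dmid R R-in-D k 0<k k< =
      R-in-D k , at-interior-≢-start (path R) k 0<k (<⇒≤ k<) , at-interior-≢-end (path R) k k<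

    Dmid⇒InB : ∀ {U x} → U x → Dmid D u′ v′ x → InB G U D u′ v′ x
    Dmid⇒InB Ux x∈Dmid@(_ , x≢u , x≢v) = Ux , x≢u , x≢v , inj₁ x∈Dmid

    D∖B⁺⇒ends : ∀ x → x ∈ D → ¬ B⁺ x → x ≡ u′ ⊎ x ≡ v′
    D∖B⁺⇒ends x x∈D x∉B⁺ with x Fin.≟ u′ | x Fin.≟ v′
    ... | yes x≡u | _       = inj₁ x≡u
    ... | no  _   | yes x≡v = inj₂ x≡v
    ... | no x≢u  | no x≢v  = ⊥-elim (x∉B⁺ (Dmid⇒InB tt (x∈D , x≢u , x≢v)))

    L+l≤hlen : L + l ≤ hlen C
    L+l≤hlen = injective-on-hole⇒≤ G C (L + l) (splice L (at (path C∖B)) shifted)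
      (splice-preserves (OnHole C) C∖B-on-C (λ k → C[D]-on-C (k ∸ L)))
      (splice-injective (at-injective (path C∖B))
        (λ j k L<j j< L<k k< e → ∸-cancelʳ-≡ (<⇒≤ L<j) (<⇒≤ L<k)
           (at-injective (path C[D]) _ _ (<⇒≤ (shifted-index L<j j<)) (<⇒≤ (shifted-index L<k k<)) e))
        (λ j k _ L<k k< e → C∖B-∉B j (subst B (sym e) (Dmid⇒InB {U = H} (at-inV (path C[D]) (k ∸ L))
           (interior-Dmid C[D] C[D]-in-D (k ∸ L) (m<n⇒0<n∸m L<k) (shifted-index L<k k<))))))
      where
      shifted : ℕ → Fin n
      shifted k = at (path C[D]) (k ∸ L)
      open Splice L (at (path C∖B)) shifted
      shifted-index : ∀ {k} → L < k → k < L + l → k ∸ L < l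
      shifted-index {k} L<k k< = +-cancelʳ-< L (k ∸ L) l (subst₂ _<_ (sym (m∸n+n≡m (<⇒≤ L<k))) (+-comm L l) k<)

    u≢v : u′ ≢ v′
    u≢v = spade-ends-distinct G sp

    u≁v : ¬ Adj G u′ v′
    u≁v = spade-ends-nonadjacent G sp

    module _ (Q : Path G OutsideB⁺ u′ v′) (Q-shortest : ∀ (R : Path G OutsideB⁺ u′ v′) → len Q ≤ len R) where

      Q′ : InducedPath G OutsideB⁺ u′ v′
      Q′ = shortest⇒InducedPath G Q Q-shortest

      module Glued {V} (R : InducedPath G V u′ v′) (R-in-D : ∀ k → at (path R) k ∈ D) = Glue G R Q′ u≢v u≁v
        (λ i j 0<i i< _ _ e → proj₂ (at-inV Q j) (subst B⁺ e (Dmid⇒InB tt (interior-Dmid R R-in-D i 0<i i<))))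
        (λ i j 0<i i< 0<j j< a → proj₂ (at-inV Q j)
          (tt , at-interior-≢-start Q j 0<j (<⇒≤ j<) , at-interior-≢-end Q j j< ,
           inj₂ (_ , interior-Dmid R R-in-D i 0<i i< , Adj-sym G a)))

      module GluedC = Glued C[D] C[D]-in-D
      module GluedP = Glued P′ (at-inV (path P′))

      -- P′ now plays the role of C[D], and C[D] that of P′.
      glued-spade : p ≡ suc l → Spade G All GluedP.hole D
      glued-spade p≡1+l = record
        { u = u′ ; v = v′
        ; D⊆U    = λ _ _ → tt
        ; small  = Spade.small sp
        ; CD     = inducedPathIn P′ (λ _ → tt)
        ; CDspan = λ x → mk⇔
            (λ o → from (GluedP.OnHole-hole x) (inj₁ o) , subst (_∈ D) (proj₂ o) (inV (path P′) (proj₁ o)))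
            (λ (on-hole , x∈D) → [ id , (λ o → ends-OnPath (path P′) (D∖B⁺⇒ends x x∈D (Q-∉B⁺ o))) ]
                                    (to (GluedP.OnHole-hole x) on-hole))
        ; P      = inducedPathIn C[D] (λ i → subst (_∈ D) (at-toℕ (path C[D]) i) (C[D]-in-D (toℕ i)))
        ; Plen   = inj₂ (sym p≡1+l)
        ; CB     = inducedPathIn Q′ (λ _ → tt)
        ; CBspan = λ x → mk⇔
            (λ o → from (GluedP.OnHole-hole x) (inj₂ o) , Q-∉B⁺ o)
            (λ (on-hole , x∉B⁺) → [ (λ o → ends-OnPath Q (D∖B⁺⇒ends x (subst (_∈ D) (proj₂ o) (inV (path P′) (proj₁ o))) x∉B⁺)) ,
                                     id ]
                                   (to (GluedP.OnHole-hole x) on-hole))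
        ; CBmin  = Q-shortest
        }
        where
        Q-∉B⁺ : ∀ {x} → OnPath Q x → ¬ B⁺ x
        Q-∉B⁺ (i , e) = subst (λ x → ¬ B⁺ x) e (proj₂ (inV Q i))

      l+q<hlen : len Q < L → l + len Q < hlen C
      l+q<hlen q<L = <-≤-trans (+-monoʳ-< l q<L) (subst (_≤ hlen C) (+-comm L l) L+l≤hlen)

      p+q-shortest : p ≡ suc l → l + len Q < hlen C → ∀ (C′ : Hole G All) → Odd {n} (hlen C′) → p + len Q ≤ hlen C′
      p+q-shortest p≡1+l l+q< C′ C′-odd =
        ≤-trans (subst (_≤ hlen C) (cong (_+ len Q) (sym p≡1+l)) l+q<) (C-odd-min C′ C′-odd)

      -- Of the glued holes, one is odd; it is shorter than C unless P′ is the longer path, and then it is shallow.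
      not-shorter : ¬ len Q < L
      not-shorter q<L with Spade.Plen sp
      ... | inj₁ p≡1+l with odd⊎odd-suc {n} (l + len Q)
      ...   | inj₁ l+q-odd = <⇒≱ (l+q<hlen q<L) (C-odd-min GluedC.hole l+q-odd)
      ...   | inj₂ l+q+1-odd = not-shallow
        (GluedP.hole , (subst (λ z → Odd {n} (z + len Q)) (sym p≡1+l) l+q+1-odd , p+q-shortest p≡1+l (l+q<hlen q<L)) ,
         D , glued-spade p≡1+l)
      not-shorter q<L | inj₂ 1+p≡l with odd⊎odd-suc {n} (p + len Q)
      ...   | inj₁ p+q-odd = <⇒≱ (<-trans (n<1+n (p + len Q)) (subst (λ z → z + len Q < hlen C) (sym 1+p≡l) (l+q<hlen q<L)))
                                  (C-odd-min GluedP.hole p+q-odd)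
      ...   | inj₂ p+q+1-odd = <⇒≱ (l+q<hlen q<L) (C-odd-min GluedC.hole (subst (λ z → Odd {n} (z + len Q)) 1+p≡l p+q+1-odd))

    C∖B-shortest : ∀ (Q : Path G OutsideB⁺ u′ v′) → L ≤ len Q
    C∖B-shortest Q = decidable-stable (L ≤? len Q) λ L≰q →
      ¬¬-argmin len Q (λ (Q₀ , Q₀-shortest) → not-shorter Q₀ Q₀-shortest (≤-<-trans (Q₀-shortest Q) (≰⇒> L≰q)))

    spade-lift : Spade G All (holeIn C (λ _ → tt)) D
    spade-lift = record
      { u = u′ ; v = v′
      ; D⊆U    = λ _ _ → tt
      ; small  = Spade.small sp
      ; CD     = inducedPathIn C[D] (λ _ → tt)
      ; CDspan = Spade.CDspan sp
      ; P      = P′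
      ; Plen   = Spade.Plen sp
      ; CB     = inducedPathIn C∖B (λ _ → tt)
      ; CBspan = λ x → mk⇔
          (λ o → let (on-C , x∉B) = to (Spade.CBspan sp x) o in
                 on-C , λ (_ , rest) → x∉B (OnHole-in-H on-C , rest))
          (λ (on-C , x∉B⁺) → from (Spade.CBspan sp x) (on-C , λ (_ , rest) → x∉B⁺ (tt , rest)))
      ; CBmin  = C∖B-shortest
      }
      where
      OnHole-in-H : ∀ {x} → OnHole C x → H x
      OnHole-in-H (i , e) = subst H e (hinU C i)

  nonShallow-restrict : ¬ Shallow G All → ¬ Shallow G H
  nonShallow-restrict not-shallow (C , C-shortest , D , sp) =
    not-shallow (holeIn C (λ _ → tt) , shortestOddHole-lift C C-shortest , D , SpadeLift.spade-lift not-shallow C C-shortest sp)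

lemma2p5 : ∀ {n : ℕ} (G : Graph n) → Connected G →
    ¬ HasHoleOfLength G 5 → ¬ HasHoleOfLength G 7 →
    (W : Subset n) →
    (Σ[ C ∈ Hole G All ] ShortestOddHole G All C × (∀ i → hvtx C i ∈ W)) →
    ((¬ Shallow G All → ¬ Shallow G (λ x → x ∈ W)) ×
     (¬ Deep G All → ¬ Deep G (λ x → x ∈ W)))
lemma2p5 G _ _ _ W (C₀ , C₀-shortest , C₀⊆W) =
  nonShallow-restrict G W C₀ C₀-shortest C₀⊆W , nonDeep-restrict G W C₀ C₀-shortest C₀⊆W
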